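{- Let $G$ be a $2$-connected graph. Then $G$ has fault cost $\varphi(G)=0$ if and only if $G$ is $1$-hamiltonian, i.e. $G$ is hamiltonian and $G-v$ is hamiltonian for every $v\in V(G)$.
   Context: Graphs are finite, simple and undirected. A graph is hamiltonian if it contains a cycle through all its vertices ($K_1$, $K_2$ are not hamiltonian). The minimum leaf number ${\rm ml}(G)$ is $1$ if $G$ is hamiltonian, $\infty$ if $G$ is disconnected, and otherwise the minimum number of leaves (degree-$1$ vertices) of a spanning tree of $G$. An ml-subgraph of $G$ is a hamiltonian cycle of $G$ if $G$ is hamiltonian, and otherwise a spanning tree of $G$ with exactly ${\rm ml}(G)$ leaves; ${\cal S}_{\rm ml}(G)$ denotes the set of all ml-subgraphs of $G$. For an ml-subgraph $S$ of $G$, a vertex $v$, and an ml-subgraph $S_v$ of $G-v$, the transition cost is $\tau(S,S_v)=|\{w\in V(G)\setminus\{v\}:\deg_S(w)\neq\deg_{S_v}(w)\}|$. Define $\varphi_S(G)=\max_{v\in V(G)}\min_{S_v\in{\cal S}_{\rm ml}(G-v)}\tau(S,S_v)$ and the fault cost $\varphi(G)=\min_{S\in{\cal S}_{\rm ml}(G)}\varphi_S(G)$. -}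

module Defs where

open import Data.Nat using (ℕ; zero; suc; _+_; _≤_; _≡ᵇ_)
open import Data.Fin using (Fin; zero; suc; toℕ; punchIn)
open import Data.Bool using (Bool; true; false; if_then_else_; not)
open import Data.Product using (Σ; _×_; _,_; ∃)
open import Data.Sum using (_⊎_)
open import Function.Definitions using (Injective)
open import Relation.Nullary using (¬_)
open import Relation.Binary.PropositionalEquality using (_≡_)

record Graph (n : ℕ) : Set where
  field
    adj    : Fin n → Fin n → Bool
    sym    : ∀ u w → adj u w ≡ adj w u
    irrefl : ∀ v → adj v v ≡ false
open Graph public

Edge : ∀ {n} → Graph n → Fin n → Fin n → Set
Edge G u w = adj G u w ≡ true

count : ∀ {n} → (Fin n → Bool) → ℕ
count {zero}  f = 0
count {suc n} f = (if f zero then 1 else 0) + count (λ i → f (suc i))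

deg : ∀ {n} → Graph n → Fin n → ℕ
deg G v = count (adj G v)

-- vertex deletion G - v; vertices of G - v are relabelled via punchIn v
_∖_ : ∀ {m} → Graph (suc m) → Fin (suc m) → Graph m
adj    (G ∖ v) i j = adj G (punchIn v i) (punchIn v j)
sym    (G ∖ v) i j = sym G (punchIn v i) (punchIn v j)
irrefl (G ∖ v) i   = irrefl G (punchIn v i)

Subgraph : ∀ {n} → Graph n → Graph n → Set
Subgraph S G = ∀ u w → Edge S u w → Edge G u w

data Reach {n} (G : Graph n) : Fin n → Fin n → Set where
  here : ∀ {u} → Reach G u u
  step : ∀ {u w x} → Edge G u w → Reach G w x → Reach G u x

Connected : ∀ {n} → Graph n → Set
Connected G = ∀ u w → Reach G u w

Consec : (k : ℕ) → Fin k → Fin k → Set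
Consec k i j = (suc (toℕ i) ≡ toℕ j) ⊎ ((suc (toℕ i) ≡ k) × (toℕ j ≡ 0))

record Cycle {n} (G : Graph n) (k : ℕ) : Set where
  field
    len≥3 : 3 ≤ k
    σ     : Fin k → Fin n
    inj   : Injective _≡_ _≡_ σ
    edges : ∀ i j → Consec k i j → Edge G (σ i) (σ j)
open Cycle public

Hamiltonian : ∀ {n} → Graph n → Set
Hamiltonian {n} G = Cycle G n

-- S is (the edge set of) a hamiltonian cycle of G
HamCycleSub : ∀ {n} → Graph n → Graph n → Set
HamCycleSub {n} G S = Σ (Cycle G n) λ C →
  ∀ u w → (Edge S u w → CEdge C u w) × (CEdge C u w → Edge S u w)
  where
  CEdge : Cycle G n → Fin n → Fin n → Set
  CEdge C u w = ∃ λ i → ∃ λ j → Consec n i j ×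
    (((u ≡ σ C i) × (w ≡ σ C j)) ⊎ ((u ≡ σ C j) × (w ≡ σ C i)))

Acyclic : ∀ {n} → Graph n → Set
Acyclic G = ∀ k → ¬ Cycle G k

SpanningTree : ∀ {n} → Graph n → Graph n → Set
SpanningTree G T = Subgraph T G × Connected T × Acyclic T

leaves : ∀ {n} → Graph n → ℕ
leaves T = count (λ v → deg T v ≡ᵇ 1)

-- ml-subgraphs: hamiltonian cycles if G is hamiltonian, otherwise spanning
-- trees with the minimum number of leaves (none if G is disconnected)
IsML : ∀ {n} → Graph n → Graph n → Set
IsML G S = (Hamiltonian G × HamCycleSub G S)
         ⊎ ((¬ Hamiltonian G) × SpanningTree G S
              × (∀ T → SpanningTree G T → leaves S ≤ leaves T))

-- transition cost τ(S, S_v): vertices w ≠ v whose degrees differ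
τ : ∀ {m} → Graph (suc m) → Fin (suc m) → Graph m → ℕ
τ S v Sv = count (λ w → not (deg S (punchIn v w) ≡ᵇ deg Sv w))

-- extended naturals for min/max with the convention min ∅ = ∞
data ℕ∞ : Set where
  fin : ℕ → ℕ∞
  ∞   : ℕ∞

data _≤∞_ : ℕ∞ → ℕ∞ → Set where
  fin≤fin : ∀ {a b} → a ≤ b → fin a ≤∞ fin b
  _≤∞∞    : ∀ x → x ≤∞ ∞

-- c is the minimum of the set P (∞ if P has no smaller element / is empty)
IsMinimum : (ℕ∞ → Set) → ℕ∞ → Set
IsMinimum P c = (P c ⊎ (c ≡ ∞)) × (∀ d → P d → c ≤∞ d)

IsMaximum : (ℕ∞ → Set) → ℕ∞ → Set
IsMaximum P c = P c × (∀ d → P d → d ≤∞ c)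

MinTransition : ∀ {m} → Graph (suc m) → Graph (suc m) → Fin (suc m) → ℕ∞ → Set
MinTransition {m} G S v =
  IsMinimum (λ d → Σ (Graph m) λ Sv → IsML (G ∖ v) Sv × (d ≡ fin (τ S v Sv)))

FaultCostOf : ∀ {m} → Graph (suc m) → Graph (suc m) → ℕ∞ → Set
FaultCostOf {m} G S =
  IsMaximum (λ d → Σ (Fin (suc m)) λ v → MinTransition G S v d)

FaultCost : ∀ {m} → Graph (suc m) → ℕ∞ → Set
FaultCost {m} G =
  IsMinimum (λ d → Σ (Graph (suc m)) λ S → IsML G S × FaultCostOf G S d)

TwoConnected : ∀ {m} → Graph (suc m) → Set
TwoConnected {m} G = (3 ≤ suc m) × Connected G × (∀ v → Connected (G ∖ v))

OneHamiltonian : ∀ {m} → Graph (suc m) → Set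
OneHamiltonian G = Hamiltonian G × (∀ v → Hamiltonian (G ∖ v))

{-# OPTIONS --safe #-}
module Submission where

-- If G and every G − v are hamiltonian, their hamiltonian cycles are 2-regular, so the
-- transition from the cycle of G to that of G − v has cost 0.  Conversely, let S be an
-- ml-subgraph with φ_S(G) = 0.  If S were a spanning tree it would have a leaf ℓ, and an
-- ml-subgraph of G − ℓ with the degrees of S would have the odd degree sum Σ deg_S − 1,
-- against the handshake lemma.  So S is a hamiltonian cycle, and a zero-cost ml-subgraph
-- of G − v is 2-regular; it contains a cycle, so it is not a tree but a hamiltonian cycle.
-- Constructively the minima defining φ need not exist, so this only shows that G − v is
-- not non-hamiltonian; hamiltonicity is decidable, which removes the double negation.

open import Defs renaming (sym to adj-sym)

open import Data.Bool using (Bool; true; false; if_then_else_; not)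
open import Data.Bool.Properties using (not-injective; ¬-not; T-≡) renaming (_≟_ to _≟ᵇ_)
open import Data.Empty using (⊥-elim)
open import Data.Fin using (Fin; zero; suc; toℕ; fromℕ; fromℕ<; inject₁; punchIn; punchOut; _≟_)
open import Data.Fin.Properties
  using (toℕ-injective; toℕ<n; toℕ-fromℕ; toℕ-fromℕ<; toℕ-inject₁; any?; all?; ¬∀⟶∃¬;
         pigeonhole; injective⇒≤; punchInᵢ≢i; punchIn-injective; punchIn-punchOut;
         punchOut-injective)
open import Data.Nat using (ℕ; zero; suc; _+_; _∸_; _≤_; _<_; z≤n; s≤s; s≤s⁻¹; _≤?_; _<?_)
open import Data.Nat.Divisibility using (_∣_; _∣0; m∣m*n; ∣m∣n⇒∣m+n; ∣m+n∣m⇒∣n; ∣1⇒≡1)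
open import Data.Nat.Properties
  using (+-assoc; +-comm; +-suc; +-identityʳ; +-monoˡ-≤; +-monoʳ-<; ≤-trans; ≤-antisym;
         <⇒≤; <-irrefl; <⇒≢; 1+n≰n; <-cmp; ≰⇒>; ≮⇒≥; n<1+n; n≤1+n; m<n⇒n≢0;
         m<1+n⇒m<n∨m≡n; m+[n∸m]≡n; m<n⇒0<n∸m; ≡ᵇ⇒≡; ≡⇒≡ᵇ; suc-injective;
         +-0-commutativeMonoid)
  renaming (_≟_ to _≟ℕ_)
open import Algebra.Properties.CommutativeMonoid.Sum +-0-commutativeMonoid
  using (sum; sum-remove; sum-cong-≗; ∑-distrib-+)
open import Data.Product using (Σ; ∃; _×_; _,_; proj₁; proj₂; map)
open import Data.Sum using (_⊎_; inj₁; inj₂; [_,_])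
open import Data.Vec.Functional using (Vector; []; _∷_; head; tail)
open import Function.Base using (_∘_; id)
open import Function.Bundles using (_⇔_; mk⇔; Equivalence)
open import Function.Definitions using (Injective)
open import Relation.Binary.Definitions using (tri<; tri≈; tri>)
open import Relation.Binary.PropositionalEquality
  using (_≡_; _≢_; _≗_; refl; sym; trans; cong; cong₂; subst; subst₂; module ≡-Reasoning)
open import Relation.Nullary using (¬_; Dec; yes; no; does)
open import Relation.Nullary.Decidable
  using (map′; _×-dec_; _⊎-dec_; _→-dec_; dec-true; dec-false; does-⇔; decidable-stable)
open import Relation.Nullary.Negation using (contradiction; ¬¬-map)
open import Relation.Unary using (Decidable)

-- Counting and degree sums

indicator : Bool → ℕ
indicator b = if b then 1 else 0

count≡∑ : ∀ {n} (f : Fin n → Bool) → count f ≡ sum (indicator ∘ f)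
count≡∑ {zero}  f = refl
count≡∑ {suc n} f = cong (indicator (f zero) +_) (count≡∑ (f ∘ suc))

count-removeAt : ∀ {n} (f : Fin (suc n) → Bool) i →
                 count f ≡ indicator (f i) + count (f ∘ punchIn i)
count-removeAt f i = begin
  count f                                           ≡⟨ count≡∑ f ⟩
  sum (indicator ∘ f)                               ≡⟨ sum-remove {i = i} (indicator ∘ f) ⟩
  indicator (f i) + sum (indicator ∘ f ∘ punchIn i) ≡⟨ cong (indicator (f i) +_) rest ⟨
  indicator (f i) + count (f ∘ punchIn i)           ∎
  where
  open ≡-Reasoning
  rest = count≡∑ (f ∘ punchIn i)

true⇒count≥1 : ∀ {n} (f : Fin n → Bool) {i} → f i ≡ true → 1 ≤ count f
true⇒count≥1 {suc n} f {i} fi rewrite count-removeAt f i | fi = s≤s z≤n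

count≡0⇒false : ∀ {n} {f : Fin n → Bool} → count f ≡ 0 → ∀ i → f i ≡ false
count≡0⇒false {f = f} none i = ¬-not (λ fi → m<n⇒n≢0 (true⇒count≥1 f fi) none)

false⇒count≡0 : ∀ {n} {f : Fin n → Bool} → (∀ i → f i ≡ false) → count f ≡ 0
false⇒count≡0 {zero}  none = refl
false⇒count≡0 {suc n} {f} none rewrite none zero = false⇒count≡0 (none ∘ suc)

count≥1⇒true : ∀ {n} (f : Fin n → Bool) → 1 ≤ count f → ∃ λ i → f i ≡ true
count≥1⇒true {suc n} f c with f zero in f0
... | true  = zero , f0
... | false = map suc id (count≥1⇒true (f ∘ suc) c)

count≥2⇒another-true : ∀ {n} (f : Fin n → Bool) → 2 ≤ count f →
                       ∀ p → ∃ λ q → q ≢ p × f q ≡ true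
count≥2⇒another-true {suc n} f c p =
  punchIn p q , punchInᵢ≢i p q , fq
  where
  indicator≤1 : ∀ b → indicator b ≤ 1
  indicator≤1 true  = s≤s z≤n
  indicator≤1 false = z≤n

  rest≥1 : 1 ≤ count (f ∘ punchIn p)
  rest≥1 = s≤s⁻¹ (≤-trans (subst (2 ≤_) (count-removeAt f p) c)
                           (+-monoˡ-≤ _ (indicator≤1 (f p))))

  q = proj₁ (count≥1⇒true (f ∘ punchIn p) rest≥1)
  fq = proj₂ (count≥1⇒true (f ∘ punchIn p) rest≥1)

unique-true⇒count≡1 : ∀ {n} {f : Fin n → Bool} {a} → f a ≡ true →
                      (∀ w → f w ≡ true → w ≡ a) → count f ≡ 1
unique-true⇒count≡1 {suc n} {f} {a} fa only = begin
  count f                                 ≡⟨ count-removeAt f a ⟩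
  indicator (f a) + count (f ∘ punchIn a) ≡⟨ cong₂ _+_ (cong indicator fa)
                                                       (false⇒count≡0 others) ⟩
  1                                       ∎
  where
  open ≡-Reasoning
  others : ∀ i → f (punchIn a i) ≡ false
  others i = ¬-not (punchInᵢ≢i a i ∘ only _)

two-trues⇒count≡2 : ∀ {n} {f : Fin n → Bool} {a b} → a ≢ b →
                    f a ≡ true → f b ≡ true → (∀ w → f w ≡ true → w ≡ a ⊎ w ≡ b) →
                    count f ≡ 2
two-trues⇒count≡2 {suc n} {f} {a} {b} a≢b fa fb only = begin
  count f                                 ≡⟨ count-removeAt f a ⟩
  indicator (f a) + count (f ∘ punchIn a) ≡⟨ cong₂ _+_ (cong indicator fa)
                                                       (unique-true⇒count≡1 fb′ only′) ⟩
  2                                       ∎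
  where
  open ≡-Reasoning
  b′ = punchOut a≢b
  fb′ : f (punchIn a b′) ≡ true
  fb′ = trans (cong f (punchIn-punchOut a≢b)) fb
  only′ : ∀ i → f (punchIn a i) ≡ true → i ≡ b′
  only′ i fi with only _ fi
  ... | inj₁ ≡a = contradiction ≡a (punchInᵢ≢i a i)
  ... | inj₂ ≡b = punchIn-injective a i b′ (trans ≡b (sym (punchIn-punchOut a≢b)))

handshake : ∀ {n} (G : Graph n) → 2 ∣ sum (deg G)
handshake {zero}  G = 2 ∣0
handshake {suc n} G =
  subst (2 ∣_) (sym split) (∣m∣n⇒∣m+n 2∣c+c (handshake (G ∖ zero)))
  where
  open ≡-Reasoning
  c = deg G zero

  2∣c+c : 2 ∣ c + c
  2∣c+c = subst (2 ∣_) (cong (c +_) (+-identityʳ c)) (m∣m*n c)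

  column : sum (λ i → indicator (adj G (suc i) zero)) ≡ c
  column = begin
    sum (λ i → indicator (adj G (suc i) zero))
      ≡⟨ sum-cong-≗ (λ i → cong indicator (adj-sym G (suc i) zero)) ⟩
    sum (λ i → indicator (adj G zero (suc i)))
      ≡⟨ count≡∑ (adj G zero ∘ suc) ⟨
    count (adj G zero ∘ suc)
      ≡⟨ cong (λ b → indicator b + count (adj G zero ∘ suc)) (irrefl G zero) ⟨
    c
      ∎

  split : sum (deg G) ≡ (c + c) + sum (deg (G ∖ zero))
  split = begin
    c + sum (λ i → indicator (adj G (suc i) zero) + deg (G ∖ zero) i)
      ≡⟨ cong (c +_) (∑-distrib-+ (λ i → indicator (adj G (suc i) zero)) (deg (G ∖ zero))) ⟩
    c + (sum (λ i → indicator (adj G (suc i) zero)) + sum (deg (G ∖ zero)))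
      ≡⟨ cong (λ x → c + (x + sum (deg (G ∖ zero)))) column ⟩
    c + (c + sum (deg (G ∖ zero)))
      ≡⟨ +-assoc c c _ ⟨
    (c + c) + sum (deg (G ∖ zero))
      ∎

τ≡0⇒deg≡ : ∀ {m} (S : Graph (suc m)) v (Sv : Graph m) →
           τ S v Sv ≡ 0 → ∀ w → deg S (punchIn v w) ≡ deg Sv w
τ≡0⇒deg≡ S v Sv τ≡0 w =
  ≡ᵇ⇒≡ _ _ (Equivalence.from T-≡ (not-injective (count≡0⇒false τ≡0 w)))

deg≡⇒τ≡0 : ∀ {m} (S : Graph (suc m)) v (Sv : Graph m) →
           (∀ w → deg S (punchIn v w) ≡ deg Sv w) → τ S v Sv ≡ 0
deg≡⇒τ≡0 S v Sv same =
  false⇒count≡0 (λ w → cong not (Equivalence.to T-≡ (≡⇒≡ᵇ _ _ (same w))))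

τ≡0⇒deg-even : ∀ {m} (S : Graph (suc m)) v (Sv : Graph m) → τ S v Sv ≡ 0 → 2 ∣ deg S v
τ≡0⇒deg-even S v Sv τ≡0 = ∣m+n∣m⇒∣n (subst (2 ∣_) split (handshake S)) (handshake Sv)
  where
  open ≡-Reasoning
  split : sum (deg S) ≡ sum (deg Sv) + deg S v
  split = begin
    sum (deg S)                       ≡⟨ sum-remove {i = v} (deg S) ⟩
    deg S v + sum (deg S ∘ punchIn v) ≡⟨ cong (deg S v +_) (sum-cong-≗ (τ≡0⇒deg≡ S v Sv τ≡0)) ⟩
    deg S v + sum (deg Sv)            ≡⟨ +-comm (deg S v) _ ⟩
    sum (deg Sv) + deg S v            ∎

-- Minimum degree two forces a cycle

least-witness : {P : ℕ → Set} → Decidable P → ∀ {n} → P n →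
                ∃ λ j → P j × (∀ {i} → i < j → ¬ P i)
least-witness {P} P? {n} Pn = search n 0 (+-identityʳ n) (λ ())
  where
  search : ∀ fuel k → fuel + k ≡ n → (∀ {i} → i < k → ¬ P i) →
           ∃ λ j → P j × (∀ {i} → i < j → ¬ P i)
  search fuel k _ below with P? k
  ... | yes Pk = k , Pk , below
  search zero k refl below | no ¬Pk = contradiction Pn ¬Pk
  search (suc fuel) k fuel+k≡n below | no ¬Pk =
    search fuel (suc k) (trans (+-suc fuel k) fuel+k≡n)
      (λ i<1+k → [ below , (λ { refl → ¬Pk }) ] (m<1+n⇒m<n∨m≡n i<1+k))

-- Walk on, never returning to the previous vertex.  The first vertex the walk revisits
-- closes a cycle, of length ≥ 3 because the walk has no loops and never backtracks.
module _ {n} (H : Graph (suc n)) (δ≥2 : ∀ u → 2 ≤ deg H u) where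

  private
    next : Fin (suc n) → Fin (suc n) → Fin (suc n)
    next p u = proj₁ (count≥2⇒another-true (adj H u) (δ≥2 u) p)

    next≢ : ∀ p u → next p u ≢ p
    next≢ p u = proj₁ (proj₂ (count≥2⇒another-true (adj H u) (δ≥2 u) p))

    next-edge : ∀ p u → Edge H u (next p u)
    next-edge p u = proj₂ (proj₂ (count≥2⇒another-true (adj H u) (δ≥2 u) p))

    walk : ℕ → Fin (suc n) × Fin (suc n)
    walk zero    = zero , next zero zero
    walk (suc i) = proj₂ (walk i) , next (proj₁ (walk i)) (proj₂ (walk i))

    x : ℕ → Fin (suc n)
    x = proj₁ ∘ walk

    x-edge : ∀ {i j} → suc i ≡ j → Edge H (x i) (x j)
    x-edge {zero}  refl = next-edge zero zero
    x-edge {suc i} refl = next-edge (x i) (x (suc i))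

    x-nonbacktracking : ∀ i → x (suc (suc i)) ≢ x i
    x-nonbacktracking i = next≢ (x i) (x (suc i))

    x-loopless : ∀ i → x (suc i) ≢ x i
    x-loopless i x′≡x = contradiction (trans (sym loop) (irrefl H (x i))) λ ()
      where
      loop : Edge H (x i) (x i)
      loop = subst (Edge H (x i)) x′≡x (x-edge {i} refl)

    closed-segment⇒cycle : ∀ a L → 0 < L → x a ≡ x (a + L) →
                           (∀ {p q} → p < q → q < a + L → x p ≢ x q) → Cycle H L
    closed-segment⇒cycle a L 0<L closed fresh = record
      { len≥3 = L≥3 L 0<L closed ; σ = σ′ ; inj = σ′-injective ; edges = σ′-edges }
      where
      L≥3 : ∀ L → 0 < L → x a ≡ x (a + L) → 3 ≤ L
      L≥3 1 _ closed = contradiction (sym (trans closed (cong x (+-comm a 1)))) (x-loopless a)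
      L≥3 2 _ closed = contradiction (sym (trans closed (cong x (+-comm a 2)))) (x-nonbacktracking a)
      L≥3 (suc (suc (suc L))) _ _ = s≤s (s≤s (s≤s z≤n))

      σ′ : Fin L → Fin (suc n)
      σ′ k = x (a + toℕ k)

      σ′-injective : Injective _≡_ _≡_ σ′
      σ′-injective {k} {k′} e with <-cmp (toℕ k) (toℕ k′)
      ... | tri< k<k′ _ _ = contradiction e       (fresh (+-monoʳ-< a k<k′) (+-monoʳ-< a (toℕ<n k′)))
      ... | tri≈ _ k≡k′ _ = toℕ-injective k≡k′
      ... | tri> _ _ k′<k = contradiction (sym e) (fresh (+-monoʳ-< a k′<k) (+-monoʳ-< a (toℕ<n k)))

      σ′-edges : ∀ i j → Consec L i j → Edge H (σ′ i) (σ′ j)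
      σ′-edges i j (inj₁ i+1≡j) = x-edge (trans (sym (+-suc a (toℕ i))) (cong (a +_) i+1≡j))
      σ′-edges i j (inj₂ (i+1≡L , j≡0)) =
        subst (Edge H (σ′ i)) wrap (x-edge (trans (sym (+-suc a (toℕ i))) (cong (a +_) i+1≡L)))
        where
        wrap : x (a + L) ≡ σ′ j
        wrap = trans (sym closed) (cong x (sym (trans (cong (a +_) j≡0) (+-identityʳ a))))

    Repeat : ℕ → Set
    Repeat j = ∃ λ (i : Fin j) → x (toℕ i) ≡ x j

    repeat? : Decidable Repeat
    repeat? j = any? (λ i → x (toℕ i) ≟ x j)

    some-repeat : ∃ Repeat
    some-repeat with pigeonhole (n<1+n (suc n)) (x ∘ toℕ)
    ... | i , j , i<j , xi≡xj = toℕ j , fromℕ< i<j , trans (cong x (toℕ-fromℕ< i<j)) xi≡xj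

  δ≥2⇒cycle : ∃ (Cycle H)
  δ≥2⇒cycle with least-witness repeat? (proj₂ some-repeat)
  ... | j , (i , xi≡xj) , unrepeated =
    j ∸ a , closed-segment⇒cycle a (j ∸ a) (m<n⇒0<n∸m (toℕ<n i)) closed fresh
    where
    a = toℕ i
    a+[j∸a]≡j : a + (j ∸ a) ≡ j
    a+[j∸a]≡j = m+[n∸m]≡n (<⇒≤ (toℕ<n i))
    closed : x a ≡ x (a + (j ∸ a))
    closed = trans xi≡xj (cong x (sym a+[j∸a]≡j))
    fresh : ∀ {p q} → p < q → q < a + (j ∸ a) → x p ≢ x q
    fresh p<q q<j xp≡xq = unrepeated (subst (_ <_) a+[j∸a]≡j q<j)
      (fromℕ< p<q , trans (cong x (toℕ-fromℕ< p<q)) xp≡xq)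

acyclic⇒deg<2 : ∀ {n} {H : Graph n} → Acyclic H → Fin n → ∃ λ u → deg H u < 2
acyclic⇒deg<2 {suc n} {H} acyclic _ with all? (λ u → 2 ≤? deg H u)
... | yes δ≥2 = contradiction (proj₂ (δ≥2⇒cycle H δ≥2)) (acyclic _)
... | no ¬δ≥2 = map id ≰⇒> (¬∀⟶∃¬ _ _ (λ u → 2 ≤? deg H u) ¬δ≥2)

connected-acyclic⇒leaf : ∀ {n} {T : Graph (suc n)} → Connected T → Acyclic T → Fin n →
                         ∃ λ ℓ → deg T ℓ ≡ 1
connected-acyclic⇒leaf {T = T} connected acyclic w
  with ℓ , deg<2 ← acyclic⇒deg<2 acyclic zero =
  ℓ , ≤-antisym (s≤s⁻¹ deg<2)
                (first-step (connected ℓ (punchIn ℓ w)) (punchInᵢ≢i ℓ w ∘ sym))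
  where
  first-step : ∀ {u v} → Reach T u v → u ≢ v → 1 ≤ deg T u
  first-step here         u≢u = contradiction refl u≢u
  first-step (step e _)   _   = true⇒count≥1 (adj T _) e

-- Hamiltonian cycles

injective⇒surjective : ∀ {n} {f : Fin n → Fin n} → Injective _≡_ _≡_ f →
                       ∀ u → ∃ λ i → f i ≡ u
injective⇒surjective {suc n} {f} f-injective u with any? (λ i → f i ≟ u)
... | yes hit = hit
... | no miss = contradiction (injective⇒≤ f′-injective) 1+n≰n
  where
  u≢f : ∀ i → u ≢ f i
  u≢f i u≡fi = miss (i , sym u≡fi)

  f′ : Fin (suc n) → Fin n
  f′ i = punchOut (u≢f i)

  f′-injective : Injective _≡_ _≡_ f′
  f′-injective e = f-injective (punchOut-injective (u≢f _) (u≢f _) e)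

consec? : ∀ {k} (i j : Fin k) → Dec (Consec k i j)
consec? {k} i j =
  (suc (toℕ i) ≟ℕ toℕ j) ⊎-dec ((suc (toℕ i) ≟ℕ k) ×-dec (toℕ j ≟ℕ 0))

consec-functional : ∀ {k} {i j j′ : Fin k} → Consec k i j → Consec k i j′ → j ≡ j′
consec-functional (inj₁ e) (inj₁ e′) = toℕ-injective (trans (sym e) e′)
consec-functional {j = j} (inj₁ e) (inj₂ (wrap , _)) =
  contradiction (trans (sym e) wrap) (<⇒≢ (toℕ<n j))
consec-functional {j′ = j′} (inj₂ (wrap , _)) (inj₁ e′) =
  contradiction (trans (sym e′) wrap) (<⇒≢ (toℕ<n j′))
consec-functional (inj₂ (_ , j≡0)) (inj₂ (_ , j′≡0)) = toℕ-injective (trans j≡0 (sym j′≡0))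

consec-injective : ∀ {k} {i i′ j : Fin k} → Consec k i j → Consec k i′ j → i ≡ i′
consec-injective (inj₁ e) (inj₁ e′) = toℕ-injective (suc-injective (trans e (sym e′)))
consec-injective (inj₁ e) (inj₂ (_ , j≡0)) = contradiction (trans e j≡0) λ ()
consec-injective (inj₂ (_ , j≡0)) (inj₁ e′) = contradiction (trans e′ j≡0) λ ()
consec-injective (inj₂ (wrap , _)) (inj₂ (wrap′ , _)) =
  toℕ-injective (suc-injective (trans wrap (sym wrap′)))

consec-successor : ∀ {k} (i : Fin k) → ∃ (Consec k i)
consec-successor {suc k} i with suc (toℕ i) <? suc k
... | yes i+1<k = fromℕ< i+1<k , inj₁ (sym (toℕ-fromℕ< i+1<k))
... | no  i+1≮k = zero , inj₂ (≤-antisym (toℕ<n i) (≮⇒≥ i+1≮k) , refl)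

consec-predecessor : ∀ {k} (j : Fin k) → ∃ λ i → Consec k i j
consec-predecessor {suc k} zero    = fromℕ k , inj₂ (cong suc (toℕ-fromℕ k) , refl)
consec-predecessor {suc k} (suc j) = inject₁ j , inj₁ (cong suc (toℕ-inject₁ j))

consec-irrefl : ∀ {k} → 2 ≤ k → {i : Fin k} → ¬ Consec k i i
consec-irrefl _   (inj₁ i+1≡i) = <-irrefl (sym i+1≡i) (n<1+n _)
consec-irrefl 2≤k (inj₂ (wrap , i≡0)) with trans (sym wrap) (cong suc i≡0)
consec-irrefl (s≤s ()) (inj₂ _) | refl

consec-asym : ∀ {k} → 3 ≤ k → {i j : Fin k} → Consec k i j → ¬ Consec k j i
consec-asym 3≤k {i} {j} = asym (toℕ i) (toℕ j) 3≤k
  where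
  asym : ∀ {k} a b → 3 ≤ k →
         (suc a ≡ b ⊎ (suc a ≡ k × b ≡ 0)) → ¬ (suc b ≡ a ⊎ (suc b ≡ k × a ≡ 0))
  asym _ _ _               (inj₁ refl)          (inj₁ ())
  asym _ _ (s≤s (s≤s ()))  (inj₁ refl)          (inj₂ (refl , refl))
  asym _ _ (s≤s (s≤s ()))  (inj₂ (refl , refl)) (inj₁ refl)

module _ {n} {G : Graph n} (C : Cycle G n) where

  CycleEdge : Fin n → Fin n → Set
  CycleEdge u w = ∃ λ i → ∃ λ j → Consec n i j ×
    (((u ≡ σ C i) × (w ≡ σ C j)) ⊎ ((u ≡ σ C j) × (w ≡ σ C i)))

  cycleEdge? : ∀ u w → Dec (CycleEdge u w)
  cycleEdge? u w = any? λ i → any? λ j → consec? i j ×-dec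
    (((u ≟ σ C i) ×-dec (w ≟ σ C j)) ⊎-dec ((u ≟ σ C j) ×-dec (w ≟ σ C i)))

  cycleEdge-sym : ∀ {u w} → CycleEdge u w → CycleEdge w u
  cycleEdge-sym (i , j , c , inj₁ (u≡ , w≡)) = i , j , c , inj₂ (w≡ , u≡)
  cycleEdge-sym (i , j , c , inj₂ (u≡ , w≡)) = i , j , c , inj₁ (w≡ , u≡)

  cycleEdge-irrefl : ∀ {u} → ¬ CycleEdge u u
  cycleEdge-irrefl {u} (i , j , c , ends) =
    consec-irrefl (≤-trans (n≤1+n 2) (len≥3 C)) (subst (Consec n i) (sym (i≡j ends)) c)
    where
    i≡j : ((u ≡ σ C i) × (u ≡ σ C j)) ⊎ ((u ≡ σ C j) × (u ≡ σ C i)) → i ≡ j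
    i≡j (inj₁ (u≡σi , u≡σj)) = inj C (trans (sym u≡σi) u≡σj)
    i≡j (inj₂ (u≡σj , u≡σi)) = inj C (trans (sym u≡σi) u≡σj)

  cycleGraph : Graph n
  adj    cycleGraph u w = does (cycleEdge? u w)
  adj-sym cycleGraph u w = does-⇔ (mk⇔ cycleEdge-sym cycleEdge-sym) (cycleEdge? u w) (cycleEdge? w u)
  irrefl cycleGraph u   = dec-false (cycleEdge? u u) cycleEdge-irrefl

  cycleGraph-isHamCycle : HamCycleSub G cycleGraph
  cycleGraph-isHamCycle = C , λ u w → edge⇒cycleEdge , dec-true (cycleEdge? u w)
    where
    edge⇒cycleEdge : ∀ {u w} → Edge cycleGraph u w → CycleEdge u w
    edge⇒cycleEdge {u} {w} e with cycleEdge? u w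
    ... | yes uw = uw

hamCycle-deg≡2 : ∀ {n} (G S : Graph n) → HamCycleSub G S → ∀ u → deg S u ≡ 2
hamCycle-deg≡2 {n} G S (C , edge⇔) u with i , σi≡u ← injective⇒surjective (inj C) u =
  two-trues⇒count≡2 succ≢pred
    (proj₂ (edge⇔ u _) (i , i⁺ , i→i⁺ , inj₁ (sym σi≡u , refl)))
    (proj₂ (edge⇔ u _) (i⁻ , i , i⁻→i , inj₂ (sym σi≡u , refl)))
    neighbours
  where
  i⁺ = proj₁ (consec-successor i)
  i→i⁺ = proj₂ (consec-successor i)
  i⁻ = proj₁ (consec-predecessor i)
  i⁻→i = proj₂ (consec-predecessor i)

  succ≢pred : σ C i⁺ ≢ σ C i⁻
  succ≢pred e =
    consec-asym (len≥3 C) i→i⁺ (subst (λ z → Consec n z i) (sym (inj C e)) i⁻→i)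

  at-i : ∀ {i′} → u ≡ σ C i′ → i ≡ i′
  at-i u≡ = inj C (trans σi≡u u≡)

  neighbours : ∀ w → Edge S u w → w ≡ σ C i⁺ ⊎ w ≡ σ C i⁻
  neighbours w e with proj₁ (edge⇔ u w) e
  ... | i′ , j′ , c , inj₁ (u≡ , w≡) = inj₁ (trans w≡ (cong (σ C) (consec-functional c′ i→i⁺)))
    where c′ = subst (λ z → Consec n z j′) (sym (at-i u≡)) c
  ... | i′ , j′ , c , inj₂ (u≡ , w≡) = inj₂ (trans w≡ (cong (σ C) (consec-injective c′ i⁻→i)))
    where c′ = subst (Consec n i′) (sym (at-i u≡)) c

-- Deciding hamiltonicity

any?-vector : ∀ {k n} {P : Vector (Fin n) k → Set} → (∀ {f g} → f ≗ g → P f → P g) →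
              (∀ f → Dec (P f)) → Dec (∃ P)
any?-vector {zero} resp P? = map′ ([] ,_) (λ (f , Pf) → resp (λ ()) Pf) (P? [])
any?-vector {suc k} resp P? =
  map′ (λ (a , f , Pa∷f) → a ∷ f , Pa∷f) (λ (f , Pf) → head f , tail f , resp η Pf)
    (any? λ a → any?-vector (resp ∘ ∷-congʳ a) (P? ∘ (a ∷_)))
  where
  η : ∀ {f : Vector (Fin _) (suc k)} → f ≗ head f ∷ tail f
  η zero    = refl
  η (suc i) = refl

  ∷-congʳ : ∀ a {f g : Vector (Fin _) k} → f ≗ g → a ∷ f ≗ a ∷ g
  ∷-congʳ a f≗g zero    = refl
  ∷-congʳ a f≗g (suc i) = f≗g i

cycle? : ∀ {n} (G : Graph n) k → Dec (Cycle G k)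
cycle? {n} G k =
  map′ (λ (3≤k , σ , σ-inj , σ-edges) →
          record { len≥3 = 3≤k ; σ = σ ; inj = σ-inj ; edges = σ-edges })
       (λ C → len≥3 C , σ C , (λ {x} {y} → inj C) , edges C)
       ((3 ≤? k) ×-dec any?-vector resp (λ σ → injective? σ ×-dec edges? σ))
  where
  Edges : Vector (Fin n) k → Set
  Edges σ = ∀ i j → Consec k i j → Edge G (σ i) (σ j)

  injective? : ∀ σ → Dec (Injective _≡_ _≡_ σ)
  injective? σ = map′ (λ inj {x} {y} → inj x y) (λ inj x y → inj)
    (all? λ x → all? λ y → (σ x ≟ σ y) →-dec (x ≟ y))

  edges? : ∀ σ → Dec (Edges σ)
  edges? σ = all? λ i → all? λ j → consec? i j →-dec (adj G (σ i) (σ j) ≟ᵇ true)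

  resp : ∀ {f g} → f ≗ g →
         Injective _≡_ _≡_ f × Edges f → Injective _≡_ _≡_ g × Edges g
  resp f≗g (f-inj , f-edges) =
    (λ {x} {y} e → f-inj (trans (f≗g x) (trans e (sym (f≗g y))))) ,
    (λ i j c → subst₂ (Edge G) (f≗g i) (f≗g j) (f-edges i j c))

-- Fault cost

0≤∞ : ∀ d → fin 0 ≤∞ d
0≤∞ (fin _) = fin≤fin z≤n
0≤∞ ∞       = fin 0 ≤∞∞

fin-injective : ∀ {a b} → fin a ≡ fin b → a ≡ b
fin-injective refl = refl

suc∞ : ℕ∞ → ℕ∞
suc∞ (fin n) = fin (suc n)
suc∞ ∞       = ∞

suc∞-mono : ∀ {d k} → d ≤∞ fin k → suc∞ d ≤∞ fin (suc k)
suc∞-mono (fin≤fin d≤k) = fin≤fin (s≤s d≤k)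

¬¬-minimum-below : ∀ n (P : ℕ∞ → Set) → P (fin n) → ¬ ¬ ∃ (IsMinimum P)
¬¬-minimum-below zero    P P0  ¬min = ¬min (fin 0 , inj₁ P0 , λ d _ → 0≤∞ d)
¬¬-minimum-below (suc n) P Pn′ ¬min = ¬¬-minimum-below n (P ∘ suc∞) Pn′ ¬min-shifted
  where
  ¬min-shifted : ¬ ∃ (IsMinimum (P ∘ suc∞))
  ¬min-shifted (d , attained , least) = ¬min (suc∞ d , attained′ attained , least′)
    where
    attained′ : P (suc∞ d) ⊎ d ≡ ∞ → P (suc∞ d) ⊎ suc∞ d ≡ ∞
    attained′ (inj₁ Pd)   = inj₁ Pd
    attained′ (inj₂ refl) = inj₂ refl

    least′ : ∀ e → P e → suc∞ d ≤∞ e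
    least′ ∞             _   = suc∞ d ≤∞∞
    least′ (fin zero)    P0  = contradiction (fin 0 , inj₁ P0 , λ e _ → 0≤∞ e) ¬min
    least′ (fin (suc k)) Pk′ = suc∞-mono (least (fin k) Pk′)

¬¬-minimum : (P : ℕ∞ → Set) → ¬ ¬ ∃ (IsMinimum P)
¬¬-minimum P ¬min = ¬min (∞ , inj₂ refl , least)
  where
  least : ∀ d → P d → ∞ ≤∞ d
  least ∞       _  = ∞ ≤∞∞
  least (fin k) Pk = contradiction ¬min (¬¬-minimum-below k P Pk)

ZeroTransition : ∀ {m} → Graph (suc m) → Graph (suc m) → Fin (suc m) → Set
ZeroTransition {m} G S v = Σ (Graph m) λ Sv → IsML (G ∖ v) Sv × τ S v Sv ≡ 0

faultCostOf-0⇒¬¬zeroTransition : ∀ {m} (G S : Graph (suc m)) → FaultCostOf G S (fin 0) →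
                                  ∀ v → ¬ ¬ ZeroTransition G S v
faultCostOf-0⇒¬¬zeroTransition G S (_ , maximal) v ¬zero =
  ¬¬-minimum _ λ (d , min) → not-min (maximal d (v , min)) min
  where
  not-min : ∀ {d} → d ≤∞ fin 0 → ¬ MinTransition G S v d
  not-min (fin≤fin z≤n) (inj₁ (Sv , ml , 0≡τ) , _) =
    ¬zero (Sv , ml , sym (fin-injective 0≡τ))
  not-min (fin≤fin z≤n) (inj₂ () , _)

zeroTransitions⇒faultCost-0 : ∀ {m} (G S : Graph (suc m)) → IsML G S →
                              (∀ v → ZeroTransition G S v) → FaultCost G (fin 0)
zeroTransitions⇒faultCost-0 G S ml zero-at =
  inj₁ (S , ml , (zero , transition zero) , λ d (v , min) → proj₂ min (fin 0) (witness v)) ,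
  λ d _ → 0≤∞ d
  where
  witness : ∀ v → Σ _ λ Sv → IsML (G ∖ v) Sv × fin 0 ≡ fin (τ S v Sv)
  witness v with Sv , ml , τ≡0 ← zero-at v = Sv , ml , cong fin (sym τ≡0)

  transition : ∀ v → MinTransition G S v (fin 0)
  transition v = inj₁ (witness v) , λ d _ → 0≤∞ d

hamCycles⇒τ≡0 : ∀ {m} (G S : Graph (suc m)) v Sv →
                HamCycleSub G S → HamCycleSub (G ∖ v) Sv → τ S v Sv ≡ 0
hamCycles⇒τ≡0 G S v Sv S-ham Sv-ham = deg≡⇒τ≡0 S v Sv λ w →
  trans (hamCycle-deg≡2 G S S-ham (punchIn v w)) (sym (hamCycle-deg≡2 (G ∖ v) Sv Sv-ham w))

hamCycle-zeroTransition⇒hamiltonian : ∀ {m} (G S : Graph (suc m)) v → HamCycleSub G S → Fin m →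
                                      ZeroTransition G S v → Hamiltonian (G ∖ v)
hamCycle-zeroTransition⇒hamiltonian _ _ _ _ _ (_ , inj₁ (ham , _) , _) = ham
hamCycle-zeroTransition⇒hamiltonian G S v S-ham w (Sv , inj₂ (_ , (_ , _ , acyclic) , _) , τ≡0)
  with u , deg<2 ← acyclic⇒deg<2 acyclic w =
  contradiction deg<2 (<-irrefl deg≡2)
  where
  deg≡2 : deg Sv u ≡ 2
  deg≡2 = trans (sym (τ≡0⇒deg≡ S v Sv τ≡0 u)) (hamCycle-deg≡2 G S S-ham (punchIn v u))

proposition3 : ∀ {m} (G : Graph (suc m)) → TwoConnected G →
    (FaultCost G (fin 0) ⇔ OneHamiltonian G)
proposition3 {zero}  G (s≤s () , _)
proposition3 {suc m} G _ = mk⇔ fault-cost-0⇒1-hamiltonian 1-hamiltonian⇒fault-cost-0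
  where
  fault-cost-0⇒1-hamiltonian : FaultCost G (fin 0) → OneHamiltonian G
  fault-cost-0⇒1-hamiltonian (inj₂ () , _)
  fault-cost-0⇒1-hamiltonian (inj₁ (S , inj₁ (ham , S-ham) , cost) , _) =
    ham , λ v → decidable-stable (cycle? (G ∖ v) _)
      (¬¬-map (hamCycle-zeroTransition⇒hamiltonian G S v S-ham zero)
              (faultCostOf-0⇒¬¬zeroTransition G S cost v))
  fault-cost-0⇒1-hamiltonian (inj₁ (S , inj₂ (_ , (_ , connected , acyclic) , _) , cost) , _)
    with ℓ , deg≡1 ← connected-acyclic⇒leaf connected acyclic zero =
    ⊥-elim (faultCostOf-0⇒¬¬zeroTransition G S cost ℓ λ (Sℓ , _ , τ≡0) →
      contradiction (∣1⇒≡1 (subst (2 ∣_) deg≡1 (τ≡0⇒deg-even S ℓ Sℓ τ≡0))) λ ())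

  1-hamiltonian⇒fault-cost-0 : OneHamiltonian G → FaultCost G (fin 0)
  1-hamiltonian⇒fault-cost-0 (C , C-del) =
    zeroTransitions⇒faultCost-0 G (cycleGraph C) (inj₁ (C , cycleGraph-isHamCycle C)) λ v →
      cycleGraph (C-del v) , inj₁ (C-del v , cycleGraph-isHamCycle (C-del v)) ,
      hamCycles⇒τ≡0 G (cycleGraph C) v (cycleGraph (C-del v))
        (cycleGraph-isHamCycle C) (cycleGraph-isHamCycle (C-del v))
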